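{- If a complete theory $T$ is $\mathrm{NTP}_2$, then $T$ is $\mathrm{NBTP}$.
   Context: $\varphi(x;y)$ has $\mathrm{TP}_2$ if there are $k<\omega$ and $(a_{i,j})_{i,j<\omega}$ such that for every $f:\omega\to\omega$, $\{\varphi(x;a_{i,f(i)}):i<\omega\}$ is consistent, and for each $i$, $\{\varphi(x;a_{i,j}):j<\omega\}$ is $k$-inconsistent; $T$ is $\mathrm{NTP}_2$ if no formula has $\mathrm{TP}_2$. Let $\omega^{<\omega}_*$ be the nonempty finite sequences of naturals with initial-segment order $\trianglelefteq$. A left-leaning path is $(\lambda_n)$ with: if $\lambda_n=\eta^\frown\langle i\rangle$ then $\eta^\frown\langle j\rangle\vartriangleleft\lambda_{n+1}$ for some $j\le i$. A right-veering path is $(\rho_n)$ with: if $\rho_n=\eta^\frown\langle i\rangle$ then $\eta^\frown\langle j\rangle\trianglelefteq\rho_{n+1}$ for some $j>i$. $\varphi(x;y)$ has $k$-$\mathrm{BTP}$ if there is $(a_\eta)_{\eta\in\omega^{<\omega}_*}$ with $\{\varphi(x;a_{\lambda_n})\}$ consistent along every left-leaning path and $\{\varphi(x;a_{\rho_n})\}$ $k$-inconsistent along every right-veering path; $T$ is $\mathrm{NBTP}$ if no formula has $k$-$\mathrm{BTP}$ for any $k<\omega$. -}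

module Defs where

open import Data.Nat using (ℕ; zero; suc; _+_; _≤_; _<_)
open import Data.Fin using (Fin)
open import Data.List using (List; []; _∷_; _++_; [_])
open import Data.Product using (Σ; _×_; _,_; ∃)
open import Data.Sum using (_⊎_)
open import Data.Empty using (⊥)
open import Data.Unit using (⊤)
open import Relation.Nullary using (¬_)
open import Relation.Binary.PropositionalEquality using (_≡_)
open import Function using (_∘_)
open import Function.Definitions using (Injective)
import Data.Vec.Functional as V

record Language : Set₁ where
  field
    Func : ℕ → Set
    Rel  : ℕ → Set

module _ (L : Language) where
  open Language L

  data Term (n : ℕ) : Set where
    var : Fin n → Term n
    app : ∀ {k} → Func k → (Fin k → Term n) → Term n

  -- formulas with free variables among Fin n (de Bruijn: variable 0 is bound by the nearest quantifier)
  data Formula (n : ℕ) : Set where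
    falsum verum : Formula n
    _≐_  : Term n → Term n → Formula n
    rel  : ∀ {k} → Rel k → (Fin k → Term n) → Formula n
    ¬'_  : Formula n → Formula n
    _∧'_ _∨'_ _⇒'_ : Formula n → Formula n → Formula n
    ∀' ∃' : Formula (suc n) → Formula n

  Sentence : Set
  Sentence = Formula 0

  Theory : Set₁
  Theory = Sentence → Set

  record Structure : Set₁ where
    field
      Carrier : Set
      funI    : ∀ {k} → Func k → (Fin k → Carrier) → Carrier
      relI    : ∀ {k} → Rel k → (Fin k → Carrier) → Set

  open Structure public

  module _ (M : Structure) where
    eval : ∀ {n} → (Fin n → Carrier M) → Term n → Carrier M
    eval ρ (var i)    = ρ i
    eval ρ (app f ts) = funI M f (λ i → eval ρ (ts i))

    Sat : ∀ {n} → (Fin n → Carrier M) → Formula n → Set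
    Sat ρ falsum     = ⊥
    Sat ρ verum      = ⊤
    Sat ρ (s ≐ t)    = eval ρ s ≡ eval ρ t
    Sat ρ (rel R ts) = relI M R (λ i → eval ρ (ts i))
    Sat ρ (¬' φ)     = ¬ Sat ρ φ
    Sat ρ (φ ∧' ψ)   = Sat ρ φ × Sat ρ ψ
    Sat ρ (φ ∨' ψ)   = Sat ρ φ ⊎ Sat ρ ψ
    Sat ρ (φ ⇒' ψ)   = Sat ρ φ → Sat ρ ψ
    Sat ρ (∀' φ)     = (a : Carrier M) → Sat (a V.∷ ρ) φ
    Sat ρ (∃' φ)     = Σ (Carrier M) λ a → Sat (a V.∷ ρ) φ

    noVars : Fin 0 → Carrier M
    noVars ()

    _⊨ₛ_ : Sentence → Set
    _⊨ₛ_ σ = Sat noVars σ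

  IsModel : Structure → Theory → Set
  IsModel M T = ∀ σ → T σ → M ⊨ₛ σ

  _⊨_ : Theory → Sentence → Set₁
  T ⊨ σ = (M : Structure) → IsModel M T → M ⊨ₛ σ

  Complete : Theory → Set₁
  Complete T = Σ Structure (λ M → IsModel M T) × (∀ σ → (T ⊨ σ) ⊎ (T ⊨ (¬' σ)))

  -- Instances φ(x; b_i) of a partitioned formula φ(x;y), x of length m, y of length n,
  -- with parameters from a model M (variables 0..m-1 are x, m..m+n-1 are y).

  module _ (M : Structure) {m n : ℕ} (φ : Formula (m + n)) where
    Consistent : {I : Set} → (I → Fin n → Carrier M) → Set
    Consistent {I} b = (N : ℕ) (g : Fin N → I) →
      Σ (Fin m → Carrier M) λ x → (r : Fin N) → Sat M (x V.++ b (g r)) φ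

    KInconsistent : ℕ → {I : Set} → (I → Fin n → Carrier M) → Set
    KInconsistent k {I} b = (g : Fin k → I) → Injective _≡_ _≡_ g →
      ¬ (Σ (Fin m → Carrier M) λ x → (r : Fin k) → Sat M (x V.++ b (g r)) φ)

  HasTP2 : Theory → ∀ {m n} → Formula (m + n) → Set₁
  HasTP2 T {m} {n} φ =
    Σ ℕ λ k → Σ Structure λ M → IsModel M T ×
    Σ (ℕ → ℕ → Fin n → Carrier M) λ a →
      ((f : ℕ → ℕ) → Consistent M {m} {n} φ (λ i → a i (f i))) ×
      ((i : ℕ) → KInconsistent M {m} {n} φ k (a i))

  NTP2 : Theory → Set₁
  NTP2 T = ∀ m n (φ : Formula (m + n)) → ¬ HasTP2 T {m} {n} φ

-- The tree ω^{<ω}_* of nonempty finite sequences.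
-- A node (η , i) stands for the sequence η⌢⟨i⟩.

Node : Set
Node = List ℕ × ℕ

⟦_⟧ : Node → List ℕ
⟦ η , i ⟧ = η ++ [ i ]

_⊴_ : List ℕ → List ℕ → Set
u ⊴ w = Σ (List ℕ) λ v → u ++ v ≡ w

_◁_ : List ℕ → List ℕ → Set
u ◁ w = Σ ℕ λ c → Σ (List ℕ) λ v → u ++ (c ∷ v) ≡ w

LeftLeaning : (ℕ → Node) → Set
LeftLeaning p = ∀ k → let (η , i) = p k in
  Σ ℕ λ j → j ≤ i × (⟦ η , j ⟧ ◁ ⟦ p (suc k) ⟧)

RightVeering : (ℕ → Node) → Set
RightVeering p = ∀ k → let (η , i) = p k in
  Σ ℕ λ j → i < j × (⟦ η , j ⟧ ⊴ ⟦ p (suc k) ⟧)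

module _ (L : Language) where

  HasKBTP : Theory L → ℕ → ∀ {m n} → Formula L (m + n) → Set₁
  HasKBTP T k {m} {n} φ =
    Σ (Structure L) λ M → IsModel L M T ×
    Σ (Node → Fin n → Carrier M) λ a →
      ((p : ℕ → Node) → LeftLeaning p → Consistent L M {m} {n} φ (a ∘ p)) ×
      ((p : ℕ → Node) → RightVeering p → KInconsistent L M {m} {n} φ k (a ∘ p))

  NBTP : Theory L → Set₁
  NBTP T = ∀ m n (φ : Formula L (m + n)) (k : ℕ) → ¬ HasKBTP T k {m} {n} φ

{-# OPTIONS --safe #-}
module Submission where

open import Defs
open import Data.Nat using (ℕ; zero; suc; _+_; z≤n)
open import Data.Nat.Properties using (n<1+n)
open import Data.List using (List; []; _∷_)
open import Data.List.Properties using (++-identityʳ)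
open import Data.Product using (_,_)
open import Relation.Binary.PropositionalEquality using (refl)

-- A k-BTP array restricted to the comb {0ⁱ⌢⟨j⟩ : i, j ∈ ω} is a TP₂ array:
-- the paths i ↦ 0ⁱ⌢⟨f(i)⟩ are left-leaning (each step passes through the
-- leftmost child 0ⁱ⌢⟨0⟩) and every row j ↦ 0ⁱ⌢⟨j⟩ is right-veering.

zeros : ℕ → List ℕ
zeros zero    = []
zeros (suc i) = ⟦ zeros i , 0 ⟧

comb : ℕ → ℕ → Node
comb i j = zeros i , j

◁-child : ∀ η i j → ⟦ η , i ⟧ ◁ ⟦ ⟦ η , i ⟧ , j ⟧
◁-child η i j = j , [] , refl

⊴-refl : ∀ u → u ⊴ u
⊴-refl u = [] , ++-identityʳ u

comb-leftLeaning : (f : ℕ → ℕ) → LeftLeaning (λ i → comb i (f i))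
comb-leftLeaning f i = 0 , z≤n , ◁-child (zeros i) 0 (f (suc i))

siblings-rightVeering : ∀ η → RightVeering (λ j → η , j)
siblings-rightVeering η j = suc j , n<1+n j , ⊴-refl ⟦ η , suc j ⟧

module _ (L : Language) (T : Theory L) {m n : ℕ} (φ : Formula L (m + n)) where

  BTP⇒TP2 : ∀ k → HasKBTP L T k {m} {n} φ → HasTP2 L T {m} {n} φ
  BTP⇒TP2 k (M , M⊨T , a , consistent , kInconsistent) =
    k , M , M⊨T , (λ i j → a (comb i j)) ,
    (λ f → consistent (λ i → comb i (f i)) (comb-leftLeaning f)) ,
    (λ i → kInconsistent (comb i) (siblings-rightVeering (zeros i)))

proposition5p3 : (L : Language) (T : Theory L) → Complete L T → NTP2 L T → NBTP L T
proposition5p3 L T _ ntp2 m n φ k btp = ntp2 m n φ (BTP⇒TP2 L T {m} {n} φ k btp)
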